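{- Let $w \in \mathfrak{S}_n$ and $k \in [1,n-1]$. Then $\max_k(w) > 1$ if and only if $w$ has an occurrence of the pattern $321$ or of the pattern $3412$ that straddles $k$ both in position and in value.
   Context: $\mathfrak{S}_n$ is the symmetric group on $[1,n]$, written in one-line notation $w=w(1)\cdots w(n)$; $\sigma_i$ is the simple reflection exchanging $i$ and $i+1$. $\max_k(w)$ is the maximum, over all reduced decompositions (minimal-length expressions as products of simple reflections) of $w$, of the number of occurrences of the factor $\sigma_k$. An occurrence of $321$ in $w$ is a triple of positions $i_1<i_2<i_3$ with $w(i_1)>w(i_2)>w(i_3)$; an occurrence of $3412$ is a quadruple of positions $i_1<i_2<i_3<i_4$ with $w(i_3)<w(i_4)<w(i_1)<w(i_2)$. A $321$-occurrence in positions $i_1<i_2<i_3$ straddles $k$ in position if $i_1\le k<i_3$; a $321$-occurrence with values $j_1<j_2<j_3$ straddles $k$ in value if $j_1\le k<j_3$. A $3412$-occurrence in positions $i_1<i_2<i_3<i_4$ straddles $k$ in position if $i_2\le k<i_3$; a $3412$-occurrence with values $j_1<j_2<j_3<j_4$ straddles $k$ in value if $j_2\le k<j_3$. A single occurrence straddles $k$ in both position and value if it satisfies both conditions. -}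

module Defs where

open import Data.Nat as ℕ using (ℕ; zero; suc; _≤_; _<_)
open import Data.Fin as Fin using (Fin; toℕ; fromℕ<)
open import Data.Fin.Permutation using (Permutation′; _⟨$⟩ʳ_)
open import Data.Fin.Permutation.Components using (transpose)
open import Data.List using (List; []; _∷_; length; filter)
open import Data.Product using (Σ; Σ-syntax; ∃; ∃-syntax; _×_; proj₁; _,_)
open import Relation.Binary.PropositionalEquality using (_≡_)
open import Function using (id; _∘_)

-- 1-based index of an element of Fin n (so Fin n encodes [1,n])
pos : ∀ {n} → Fin n → ℕ
pos i = suc (toℕ i)

-- A letter σ_k, k ∈ [1,n-1]: stored as a : Fin n (0-based) with pos a = k,
-- together with the proof that k < n.
Letter : ℕ → Set
Letter n = Σ[ a ∈ Fin n ] (suc (toℕ a) < n)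

index : ∀ {n} → Letter n → ℕ
index (a , _) = pos a

σ : ∀ {n} → Letter n → Fin n → Fin n
σ (a , p) = transpose a (fromℕ< p)

⟦_⟧ : ∀ {n} → List (Letter n) → Fin n → Fin n
⟦ [] ⟧ = id
⟦ l ∷ ls ⟧ = σ l ∘ ⟦ ls ⟧

IsDecomposition : ∀ {n} → Permutation′ n → List (Letter n) → Set
IsDecomposition w ws = ∀ i → ⟦ ws ⟧ i ≡ w ⟨$⟩ʳ i

IsReduced : ∀ {n} → Permutation′ n → List (Letter n) → Set
IsReduced w ws = IsDecomposition w ws ×
  (∀ vs → IsDecomposition w vs → length ws ≤ length vs)

occurrences : ∀ {n} → ℕ → List (Letter n) → ℕ
occurrences k ws = length (filter (λ l → index l ℕ.≟ k) ws)

-- max_k(w) > m : some reduced decomposition of w has more than m factors σ_k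
-- (max over the finite nonempty set of reduced decompositions)
MaxkGreater : ∀ {n} → Permutation′ n → ℕ → ℕ → Set
MaxkGreater w k m = ∃[ ws ] (IsReduced w ws × m < occurrences k ws)

Straddle321 : ∀ {n} → Permutation′ n → ℕ → Set
Straddle321 {n} w k = Σ[ i₁ ∈ Fin n ] Σ[ i₂ ∈ Fin n ] Σ[ i₃ ∈ Fin n ]
  ( (i₁ Fin.< i₂) × (i₂ Fin.< i₃)
  × (w ⟨$⟩ʳ i₂ Fin.< w ⟨$⟩ʳ i₁) × (w ⟨$⟩ʳ i₃ Fin.< w ⟨$⟩ʳ i₂)
  × (pos i₁ ≤ k) × (k < pos i₃)
  × (pos (w ⟨$⟩ʳ i₃) ≤ k) × (k < pos (w ⟨$⟩ʳ i₁)) )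

Straddle3412 : ∀ {n} → Permutation′ n → ℕ → Set
Straddle3412 {n} w k =
  Σ[ i₁ ∈ Fin n ] Σ[ i₂ ∈ Fin n ] Σ[ i₃ ∈ Fin n ] Σ[ i₄ ∈ Fin n ]
  ( (i₁ Fin.< i₂) × (i₂ Fin.< i₃) × (i₃ Fin.< i₄)
  × (w ⟨$⟩ʳ i₃ Fin.< w ⟨$⟩ʳ i₄) × (w ⟨$⟩ʳ i₄ Fin.< w ⟨$⟩ʳ i₁)
  × (w ⟨$⟩ʳ i₁ Fin.< w ⟨$⟩ʳ i₂)
  × (pos i₂ ≤ k) × (k < pos i₃)
  × (pos (w ⟨$⟩ʳ i₄) ≤ k) × (k < pos (w ⟨$⟩ʳ i₁)) )

-- Permutations of [0, n) are modelled as functions ℕ → ℕ, and c = k - 1, so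
-- σ_k is the adjacent swap of c and c+1; "the cut" lies between c and c+1.
-- 1. Inversions.  Composing with an adjacent swap changes the number of
--    inversions by exactly one, so a word is reduced iff it is rising (each
--    letter creates an inversion), and bubble sort gives every permutation
--    a rising word.
-- 2. Forward.  Split a reduced word at its last two letters c.  If one of
--    these swaps exchanges two values on the same side of the cut, the
--    pigeonhole principle produces a straddling 321, which survives the
--    remaining rising suffix; otherwise the four positions the two swaps
--    touch give two crossers of the cut on each side, hence a 321 or 3412.
-- 3. Backward.  Bubble the inverted pair of the pattern to (c, c+1) and swap
--    it; the third entry of the pattern remains a crosser of the cut, so
--    every reduced word of what is left uses c once more.
-- 4. Finally the model is matched with the Fin-based definitions of Defs.
module Submission where

open import Defs
open import Data.Nat using (ℕ; _≤_; _<_)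
open import Data.Sum using (_⊎_)
open import Data.Fin.Permutation using (Permutation′)
open import Function.Bundles using (_⇔_)

open import Data.Nat
open import Data.Nat.Properties
open import Data.Nat.Solver using (module +-*-Solver)
open import Data.Fin as Fin using (Fin; toℕ; fromℕ<)
open import Data.Fin.Properties using (injective⇒≤; toℕ-fromℕ<; toℕ<n; fromℕ<-toℕ; toℕ-injective; fromℕ<-injective)
open import Data.Fin.Permutation using (_⟨$⟩ʳ_; _⟨$⟩ˡ_; inverseˡ)
open import Data.Fin.Permutation.Components using (transpose)
open import Data.Product using (Σ; ∃; ∃₂; _×_; _,_; proj₁; proj₂)
open import Data.Sum as Sum using (inj₁; inj₂)
open import Data.Empty using (⊥-elim)
open import Data.Unit using (⊤; tt)
open import Data.List using (List; []; _∷_; _++_; [_]; length; map; filter)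
open import Data.List.Properties using (++-assoc; filter-++; length-++; length-map; filter-accept; filter-reject)
open import Data.List.Relation.Unary.All using (All; []; _∷_)
open import Data.List.Relation.Unary.All.Properties using (++⁺; ++⁻ʳ)
open import Relation.Nullary using (¬_; yes; no)
open import Relation.Nullary.Decidable using (_×-dec_)
open import Relation.Binary.Definitions using (tri<; tri≈; tri>)
open import Relation.Binary.PropositionalEquality hiding ([_])
open import Function using (_∘_; id)
open import Function.Bundles using (mk⇔)

open +-*-Solver using (solve; _:+_; _:=_)

-- swap a exchanges a and a+1 and fixes every other number: the simple
-- reflection σ_{a+1} acting on the 0-based positions ℕ.
swap : ℕ → ℕ → ℕ
swap zero    zero          = 1
swap zero    (suc zero)    = 0
swap zero    (suc (suc x)) = suc (suc x)
swap (suc a) zero          = zero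
swap (suc a) (suc x)       = suc (swap a x)

swap-left : ∀ a → swap a a ≡ suc a
swap-left zero    = refl
swap-left (suc a) = cong suc (swap-left a)

swap-right : ∀ a → swap a (suc a) ≡ a
swap-right zero    = refl
swap-right (suc a) = cong suc (swap-right a)

swap-fixed : ∀ a x → x ≢ a → x ≢ suc a → swap a x ≡ x
swap-fixed zero    zero          x≢a _   = ⊥-elim (x≢a refl)
swap-fixed zero    (suc zero)    _   x≢1 = ⊥-elim (x≢1 refl)
swap-fixed zero    (suc (suc x)) _   _   = refl
swap-fixed (suc a) zero          _   _   = refl
swap-fixed (suc a) (suc x)       x≢a x≢b =
  cong suc (swap-fixed a x (x≢a ∘ cong suc) (x≢b ∘ cong suc))

swap-involutive : ∀ a x → swap a (swap a x) ≡ x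
swap-involutive zero    zero          = refl
swap-involutive zero    (suc zero)    = refl
swap-involutive zero    (suc (suc x)) = refl
swap-involutive (suc a) zero          = refl
swap-involutive (suc a) (suc x)       = cong suc (swap-involutive a x)

swap-injective : ∀ a {x y} → swap a x ≡ swap a y → x ≡ y
swap-injective a {x} {y} e = begin
  x                   ≡⟨ sym (swap-involutive a x) ⟩
  swap a (swap a x)   ≡⟨ cong (swap a) e ⟩
  swap a (swap a y)   ≡⟨ swap-involutive a y ⟩
  y                   ∎
  where open ≡-Reasoning

data SwapView (a x : ℕ) : Set where
  at-left  : x ≡ a → swap a x ≡ suc a → SwapView a x
  at-right : x ≡ suc a → swap a x ≡ a → SwapView a x
  elsewhere : x ≢ a → x ≢ suc a → swap a x ≡ x → SwapView a x

swapView : ∀ a x → SwapView a x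
swapView a x with x ≟ a | x ≟ suc a
... | yes refl | _        = at-left refl (swap-left a)
... | no x≢a   | yes refl = at-right refl (swap-right a)
... | no x≢a   | no x≢b   = elsewhere x≢a x≢b (swap-fixed a x x≢a x≢b)

swap-< : ∀ {n} a x → suc a < n → x < n → swap a x < n
swap-< a x a<n x<n with swapView a x
... | at-left _ e    rewrite e = a<n
... | at-right _ e   rewrite e = <-trans (n<1+n a) a<n
... | elsewhere _ _ e rewrite e = x<n

swap-keeps-≤ : ∀ a c x → a ≢ c → x ≤ c → swap a x ≤ c
swap-keeps-≤ a c x a≢c x≤c with swapView a x
... | at-left refl e  rewrite e = ≤∧≢⇒< x≤c a≢c
... | at-right refl e rewrite e = ≤-trans (n≤1+n a) x≤c
... | elsewhere _ _ e rewrite e = x≤c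

swap-keeps-> : ∀ a c x → a ≢ c → c < x → c < swap a x
swap-keeps-> a c x a≢c c<x with swapView a x
... | at-left refl e  rewrite e = <-trans c<x (n<1+n x)
... | at-right refl e rewrite e = ≤∧≢⇒< (≤-pred c<x) (a≢c ∘ sym)
... | elsewhere _ _ e rewrite e = c<x

swap-monotone : ∀ a i j → i < j → ¬ (i ≡ a × j ≡ suc a) → swap a i < swap a j
swap-monotone a i j i<j not-ab with swapView a i | swapView a j
... | at-left refl _    | at-left refl _    = ⊥-elim (<-irrefl refl i<j)
... | at-left refl _    | at-right refl _   = ⊥-elim (not-ab (refl , refl))
... | at-left refl e₁   | elsewhere _ j≢b e₂ rewrite e₁ | e₂ = ≤∧≢⇒< i<j (j≢b ∘ sym)
... | at-right refl _   | at-left refl _    = ⊥-elim (<-asym i<j (n<1+n _))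
... | at-right refl _   | at-right refl _   = ⊥-elim (<-irrefl refl i<j)
... | at-right refl e₁  | elsewhere _ _ e₂  rewrite e₁ | e₂ = <-trans (n<1+n a) i<j
... | elsewhere _ _ e₁  | at-left refl e₂   rewrite e₁ | e₂ = <-trans i<j (n<1+n j)
... | elsewhere i≢a _ e₁ | at-right refl e₂ rewrite e₁ | e₂ = ≤∧≢⇒< (≤-pred i<j) i≢a
... | elsewhere _ _ e₁  | elsewhere _ _ e₂  rewrite e₁ | e₂ = i<j

lessThan : ℕ → ℕ → ℕ
lessThan _       zero    = 0
lessThan zero    (suc _) = 1
lessThan (suc x) (suc y) = lessThan x y

lessThan-1 : ∀ {x y} → x < y → lessThan x y ≡ 1
lessThan-1 {zero}  {suc y} _       = refl
lessThan-1 {suc x} {suc y} (s≤s h) = lessThan-1 h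

lessThan-0 : ∀ {x y} → y ≤ x → lessThan x y ≡ 0
lessThan-0 {x}     {zero}  _       = refl
lessThan-0 {suc x} {suc y} (s≤s h) = lessThan-0 h

lessThan-≤1 : ∀ x y → lessThan x y ≤ 1
lessThan-≤1 _       zero    = z≤n
lessThan-≤1 zero    (suc _) = ≤-refl
lessThan-≤1 (suc x) (suc y) = lessThan-≤1 x y

countBelow : ℕ → ℕ → (ℕ → ℕ) → ℕ
countBelow zero    v g = 0
countBelow (suc m) v g = lessThan (g 0) v + countBelow m v (g ∘ suc)

inversions : ℕ → (ℕ → ℕ) → ℕ
inversions zero    f = 0
inversions (suc m) f = countBelow m (f 0) (f ∘ suc) + inversions m (f ∘ suc)

Agree : ℕ → (ℕ → ℕ) → (ℕ → ℕ) → Set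
Agree n f g = ∀ x → x < n → f x ≡ g x

countBelow-agree : ∀ m {v v′ g h} → v ≡ v′ → Agree m g h →
  countBelow m v g ≡ countBelow m v′ h
countBelow-agree zero    _ _  = refl
countBelow-agree (suc m) e ag =
  cong₂ _+_ (cong₂ lessThan (ag 0 z<s) e) (countBelow-agree m e (λ x → ag (suc x) ∘ s≤s))

inversions-agree : ∀ m {f g} → Agree m f g → inversions m f ≡ inversions m g
inversions-agree zero    _  = refl
inversions-agree (suc m) ag =
  cong₂ _+_ (countBelow-agree m (ag 0 z<s) (λ x → ag (suc x) ∘ s≤s))
            (inversions-agree m (λ x → ag (suc x) ∘ s≤s))

countBelow-swap : ∀ m a v g → suc a < m →
  countBelow m v (g ∘ swap a) ≡ countBelow m v g
countBelow-swap (suc (suc m)) zero v g _ =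
  solve 3 (λ x y z → x :+ (y :+ z) := y :+ (x :+ z)) refl
    (lessThan (g 1) v) (lessThan (g 0) v) (countBelow m v (g ∘ suc ∘ suc))
countBelow-swap (suc m) (suc a) v g (s≤s h) =
  cong (lessThan (g 0) v +_) (countBelow-swap m a v (g ∘ suc) h)

-- The basic exchange law: composing with swap a toggles exactly the pair
-- (a, a+1) between inversion and non-inversion.
inversions-swap : ∀ n a f → suc a < n →
  inversions n (f ∘ swap a) + lessThan (f (suc a)) (f a) ≡ inversions n f + lessThan (f a) (f (suc a))
inversions-swap (suc (suc m)) zero f _ =
  solve 5 (λ p q a b i → (p :+ a) :+ (b :+ i) :+ q := (q :+ b) :+ (a :+ i) :+ p) refl
    (lessThan (f 0) (f 1)) (lessThan (f 1) (f 0)) (countBelow m (f 1) (f ∘ suc ∘ suc))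
    (countBelow m (f 0) (f ∘ suc ∘ suc)) (inversions m (f ∘ suc ∘ suc))
inversions-swap (suc m) (suc a) f (s≤s h) = begin
  (C′ + I′) + l₁ ≡⟨ +-assoc C′ I′ l₁ ⟩
  C′ + (I′ + l₁) ≡⟨ cong₂ _+_ (countBelow-swap m a (f 0) (f ∘ suc) h) (inversions-swap m a (f ∘ suc) h) ⟩
  C + (I + l₂)   ≡⟨ sym (+-assoc C I l₂) ⟩
  (C + I) + l₂   ∎
  where
  open ≡-Reasoning
  C′ = countBelow m (f 0) (f ∘ suc ∘ swap a)
  I′ = inversions m (f ∘ suc ∘ swap a)
  C  = countBelow m (f 0) (f ∘ suc)
  I  = inversions m (f ∘ suc)
  l₁ = lessThan (f (suc (suc a))) (f (suc a))
  l₂ = lessThan (f (suc a)) (f (suc (suc a)))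

inversions-swap-≤ : ∀ n a f → suc a < n → inversions n (f ∘ swap a) ≤ inversions n f + 1
inversions-swap-≤ n a f h = begin
  inversions n (f ∘ swap a)                                ≤⟨ m≤m+n _ _ ⟩
  inversions n (f ∘ swap a) + lessThan (f (suc a)) (f a)       ≡⟨ inversions-swap n a f h ⟩
  inversions n f + lessThan (f a) (f (suc a))                  ≤⟨ +-monoʳ-≤ (inversions n f) (lessThan-≤1 (f a) (f (suc a))) ⟩
  inversions n f + 1                                       ∎
  where open ≤-Reasoning

inversions-swap-ascent : ∀ n a f → suc a < n → f a < f (suc a) →
  inversions n (f ∘ swap a) ≡ suc (inversions n f)
inversions-swap-ascent n a f h asc = begin
  inversions n (f ∘ swap a)                            ≡⟨ sym (+-identityʳ _) ⟩
  inversions n (f ∘ swap a) + 0                        ≡⟨ cong (inversions n (f ∘ swap a) +_) (sym (lessThan-0 (<⇒≤ asc))) ⟩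
  inversions n (f ∘ swap a) + lessThan (f (suc a)) (f a)   ≡⟨ inversions-swap n a f h ⟩
  inversions n f + lessThan (f a) (f (suc a))              ≡⟨ cong (inversions n f +_) (lessThan-1 asc) ⟩
  inversions n f + 1                                   ≡⟨ +-comm (inversions n f) 1 ⟩
  suc (inversions n f)                                 ∎
  where open ≡-Reasoning

inversions-swap-non-ascent : ∀ n a f → suc a < n → f (suc a) ≤ f a →
  inversions n (f ∘ swap a) ≤ inversions n f
inversions-swap-non-ascent n a f h nasc = begin
  inversions n (f ∘ swap a)                            ≤⟨ m≤m+n _ _ ⟩
  inversions n (f ∘ swap a) + lessThan (f (suc a)) (f a)   ≡⟨ inversions-swap n a f h ⟩
  inversions n f + lessThan (f a) (f (suc a))              ≡⟨ cong (inversions n f +_) (lessThan-0 nasc) ⟩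
  inversions n f + 0                                   ≡⟨ +-identityʳ _ ⟩
  inversions n f                                       ∎
  where open ≤-Reasoning

countBelow-none : ∀ m v g → (∀ x → v ≤ g x) → countBelow m v g ≡ 0
countBelow-none zero    v g h = refl
countBelow-none (suc m) v g h rewrite lessThan-0 {g 0} {v} (h 0) = countBelow-none m v (g ∘ suc) (h ∘ suc)

inversions-shift : ∀ n m → inversions n (m +_) ≡ 0
inversions-shift zero    m = refl
inversions-shift (suc n) m
  rewrite countBelow-none n (m + 0) (λ x → m + suc x) (λ x → +-monoʳ-≤ m z≤n) =
  trans (inversions-agree n (λ x _ → +-suc m x)) (inversions-shift n (suc m))

inversions-id : ∀ n → inversions n id ≡ 0
inversions-id n = inversions-shift n 0

-- A word for S_n: a list of letters a with a+1 < n, the letter a standing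
-- for the simple reflection swap a.
Word : ℕ → List ℕ → Set
Word n = All (λ a → suc a < n)

apply : List ℕ → ℕ → ℕ
apply []       = id
apply (a ∷ as) = swap a ∘ apply as

pullback : List ℕ → ℕ → ℕ
pullback []       = id
pullback (a ∷ as) = pullback as ∘ swap a

apply-++ : ∀ xs ys x → apply (xs ++ ys) x ≡ apply xs (apply ys x)
apply-++ []       ys x = refl
apply-++ (a ∷ xs) ys x = cong (swap a) (apply-++ xs ys x)

pullback-++ : ∀ xs ys x → pullback (xs ++ ys) x ≡ pullback ys (pullback xs x)
pullback-++ []       ys x = refl
pullback-++ (a ∷ xs) ys x = pullback-++ xs ys (swap a x)

apply-pullback : ∀ us x → apply us (pullback us x) ≡ x
apply-pullback []       x = refl
apply-pullback (a ∷ as) x = trans (cong (swap a) (apply-pullback as (swap a x))) (swap-involutive a x)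

apply-< : ∀ {n} us x → Word n us → x < n → apply us x < n
apply-< []       x []       x<n = x<n
apply-< (a ∷ as) x (h ∷ v) x<n = swap-< a _ h (apply-< as x v x<n)

pullback-< : ∀ {n} us x → Word n us → x < n → pullback us x < n
pullback-< []       x []      x<n = x<n
pullback-< (a ∷ as) x (h ∷ v) x<n = pullback-< as (swap a x) v (swap-< a x h x<n)

pullback-injective : ∀ us {x y} → pullback us x ≡ pullback us y → x ≡ y
pullback-injective []       e = e
pullback-injective (a ∷ as) e = swap-injective a (pullback-injective as e)

Inj : ℕ → (ℕ → ℕ) → Set
Inj n f = ∀ x y → x < n → y < n → f x ≡ f y → x ≡ y

Bnd : ℕ → (ℕ → ℕ) → Set
Bnd n f = ∀ x → x < n → f x < n

inj-swap : ∀ n a f → suc a < n → Inj n f → Inj n (f ∘ swap a)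
inj-swap n a f h inj x y x<n y<n e = swap-injective a (inj _ _ (swap-< a x h x<n) (swap-< a y h y<n) e)

bnd-swap : ∀ n a f → suc a < n → Bnd n f → Bnd n (f ∘ swap a)
bnd-swap n a f h bnd x x<n = bnd _ (swap-< a x h x<n)

-- Rising p us: reading us from the left, every letter a hits an ascent of
-- the current function (which then becomes p ∘ swap a), i.e. every letter
-- creates a new inversion.
Rising : (ℕ → ℕ) → List ℕ → Set
Rising p []       = ⊤
Rising p (a ∷ as) = p a < p (suc a) × Rising (p ∘ swap a) as

rising-++⁻ : ∀ p xs ys → Rising p (xs ++ ys) → Rising p xs × Rising (p ∘ apply xs) ys
rising-++⁻ p []       ys r         = tt , r
rising-++⁻ p (a ∷ xs) ys (asc , r) =
  let r₁ , r₂ = rising-++⁻ (p ∘ swap a) xs ys r in (asc , r₁) , r₂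

rising-++⁺ : ∀ p xs ys → Rising p xs → Rising (p ∘ apply xs) ys → Rising p (xs ++ ys)
rising-++⁺ p []       ys tt        r₂ = r₂
rising-++⁺ p (a ∷ xs) ys (asc , r₁) r₂ = asc , rising-++⁺ (p ∘ swap a) xs ys r₁ r₂

rising-agree : ∀ {n} p q us → Agree n p q → Word n us → Rising p us → Rising q us
rising-agree p q []       _  []      tt        = tt
rising-agree p q (a ∷ as) ag (h ∷ v) (asc , r) =
  subst₂ _<_ (ag a (<-trans (n<1+n a) h)) (ag (suc a) h) asc ,
  rising-agree (p ∘ swap a) (q ∘ swap a) as (λ x x<n → ag (swap a x) (swap-< a x h x<n)) v r

pullback-order : ∀ p us i j → Rising p us → i < j → p j < p i → pullback us i < pullback us j
pullback-order p []       i j tt        i<j _   = i<j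
pullback-order p (a ∷ as) i j (asc , r) i<j inv =
  pullback-order (p ∘ swap a) as (swap a i) (swap a j) r (swap-monotone a i j i<j not-ascent) inv′
  where
  not-ascent : ¬ (i ≡ a × j ≡ suc a)
  not-ascent (refl , refl) = <-asym asc inv
  inv′ : p (swap a (swap a j)) < p (swap a (swap a i))
  inv′ rewrite swap-involutive a j | swap-involutive a i = inv

inversions-apply-≤ : ∀ n p us → Word n us → inversions n (p ∘ apply us) ≤ inversions n p + length us
inversions-apply-≤ n p []       []      = ≤-reflexive (sym (+-identityʳ _))
inversions-apply-≤ n p (a ∷ as) (h ∷ v) = begin
  inversions n (p ∘ swap a ∘ apply as)   ≤⟨ inversions-apply-≤ n (p ∘ swap a) as v ⟩
  inversions n (p ∘ swap a) + length as  ≤⟨ +-monoˡ-≤ (length as) (inversions-swap-≤ n a p h) ⟩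
  inversions n p + 1 + length as         ≡⟨ +-assoc (inversions n p) 1 (length as) ⟩
  inversions n p + suc (length as)       ∎
  where open ≤-Reasoning

rising⇒inversions : ∀ n p us → Word n us → Rising p us →
  inversions n (p ∘ apply us) ≡ inversions n p + length us
rising⇒inversions n p []       []      tt        = sym (+-identityʳ _)
rising⇒inversions n p (a ∷ as) (h ∷ v) (asc , r) = begin
  inversions n (p ∘ swap a ∘ apply as)   ≡⟨ rising⇒inversions n (p ∘ swap a) as v r ⟩
  inversions n (p ∘ swap a) + length as  ≡⟨ cong (_+ length as) (inversions-swap-ascent n a p h asc) ⟩
  suc (inversions n p) + length as       ≡⟨ sym (+-suc (inversions n p) (length as)) ⟩
  inversions n p + suc (length as)       ∎
  where open ≡-Reasoning

inversions⇒rising : ∀ n p us → Word n us →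
  inversions n (p ∘ apply us) ≡ inversions n p + length us → Rising p us
inversions⇒rising n p []       []      _ = tt
inversions⇒rising n p (a ∷ as) (h ∷ v) e with p a <? p (suc a)
... | yes asc = asc , inversions⇒rising n (p ∘ swap a) as v (begin
  inversions n (p ∘ swap a ∘ apply as)   ≡⟨ e ⟩
  inversions n p + suc (length as)       ≡⟨ +-suc (inversions n p) (length as) ⟩
  suc (inversions n p) + length as       ≡⟨ cong (_+ length as) (sym (inversions-swap-ascent n a p h asc)) ⟩
  inversions n (p ∘ swap a) + length as  ∎)
  where open ≡-Reasoning
... | no ¬asc = ⊥-elim (<-irrefl e too-few)
  where
  open ≤-Reasoning
  too-few : inversions n (p ∘ swap a ∘ apply as) < inversions n p + suc (length as)
  too-few = begin-strict
    inversions n (p ∘ swap a ∘ apply as)   ≤⟨ inversions-apply-≤ n (p ∘ swap a) as v ⟩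
    inversions n (p ∘ swap a) + length as  ≤⟨ +-monoˡ-≤ (length as) (inversions-swap-non-ascent n a p h (≮⇒≥ ¬asc)) ⟩
    inversions n p + length as             <⟨ +-monoʳ-< (inversions n p) (n<1+n (length as)) ⟩
    inversions n p + suc (length as)       ∎

-- RisingFactor n f g us: on [0, n), f = g ∘ apply us with us rising from g,
-- so that f has exactly length us more inversions than g.
RisingFactor : ℕ → (ℕ → ℕ) → (ℕ → ℕ) → List ℕ → Set
RisingFactor n f g us = Word n us × Rising g us × Agree n (g ∘ apply us) f

factor-refl : ∀ n f → RisingFactor n f f []
factor-refl n f = [] , tt , λ _ _ → refl

factor-descent : ∀ n f a → suc a < n → f (suc a) < f a → RisingFactor n f (f ∘ swap a) [ a ]
factor-descent n f a h desc = (h ∷ []) , (asc , tt) , λ x _ → cong f (swap-involutive a x)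
  where
  asc : f (swap a a) < f (swap a (suc a))
  asc rewrite swap-left a | swap-right a = desc

factor-trans : ∀ {n f g h} us₁ us₂ → RisingFactor n f g us₁ → RisingFactor n g h us₂ →
  RisingFactor n f h (us₂ ++ us₁)
factor-trans {n} {f} {g} {h} us₁ us₂ (v₁ , r₁ , ag₁) (v₂ , r₂ , ag₂) =
  ++⁺ v₂ v₁ ,
  rising-++⁺ h us₂ us₁ r₂ (rising-agree g (h ∘ apply us₂) us₁ (λ x x<n → sym (ag₂ x x<n)) v₁ r₁) ,
  λ x x<n → begin
    h (apply (us₂ ++ us₁) x)        ≡⟨ cong h (apply-++ us₂ us₁ x) ⟩
    h (apply us₂ (apply us₁ x))     ≡⟨ ag₂ _ (apply-< us₁ x v₁ x<n) ⟩
    g (apply us₁ x)                 ≡⟨ ag₁ x x<n ⟩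
    f x                             ∎
  where open ≡-Reasoning

factor-++⁻ : ∀ {n f g} xs ys → RisingFactor n f g (xs ++ ys) → RisingFactor n f (g ∘ apply xs) ys
factor-++⁻ {n} {f} {g} xs ys (v , r , ag) =
  ++⁻ʳ xs v , proj₂ (rising-++⁻ g xs ys r) ,
  λ x x<n → trans (cong g (sym (apply-++ xs ys x))) (ag x x<n)

factor-pullback : ∀ {n f g us} → RisingFactor n f g us → ∀ z → z < n → f (pullback us z) ≡ g z
factor-pullback {g = g} {us} (v , _ , ag) z z<n =
  trans (sym (ag _ (pullback-< us z v z<n))) (cong g (apply-pullback us z))

-- On [0, n), g = f ∘ pullback us; hence g is a permutation when f is.
factor-inj : ∀ {n f g us} → RisingFactor n f g us → Inj n f → Inj n g
factor-inj {us = us} fac@(v , _ , _) inj x y x<n y<n e =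
  pullback-injective us (inj _ _ (pullback-< us x v x<n) (pullback-< us y v y<n)
    (trans (factor-pullback fac x x<n) (trans e (sym (factor-pullback fac y y<n)))))

factor-bnd : ∀ {n f g us} → RisingFactor n f g us → Bnd n f → Bnd n g
factor-bnd {us = us} fac@(v , _ , _) bnd x x<n =
  subst (_< _) (factor-pullback fac x x<n) (bnd _ (pullback-< us x v x<n))

ascending-id : ∀ n f → (∀ a → suc a < n → f a < f (suc a)) → Bnd n f → ∀ x → x < n → f x ≡ x
ascending-id n f asc bnd x x<n = ≤-antisym (≤-pred (+-cancelʳ-< d (f x) (suc x) f+d<)) (above x x<n)
  where
  above : ∀ x → x < n → x ≤ f x
  above zero    _   = z≤n
  above (suc x) x<n = ≤-<-trans (above x (<-trans (n<1+n x) x<n)) (asc x x<n)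
  room : ∀ d x → x + d < n → f x + d < n
  room zero    x h rewrite +-identityʳ x | +-identityʳ (f x) = bnd x h
  room (suc d) x h = begin-strict
    f x + suc d        ≡⟨ +-suc (f x) d ⟩
    suc (f x) + d      ≤⟨ +-monoˡ-≤ d (asc x (≤-<-trans (m≤m+n (suc x) d) h′)) ⟩
    f (suc x) + d      <⟨ room d (suc x) h′ ⟩
    n                  ∎
    where
    open ≤-Reasoning
    h′ : suc x + d < n
    h′ = subst (_< n) (+-suc x d) h
  d : ℕ
  d = n ∸ suc x
  f+d< : f x + d < suc x + d
  f+d< = subst (f x + d <_) (sym (m+[n∸m]≡n x<n))
           (room d x (subst (x + d <_) (m+[n∸m]≡n x<n) (n<1+n (x + d))))

-- Bubble sort: every permutation f is apply vs for a word vs rising from the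
-- identity (by induction on the number of inversions, splitting off a descent).
sortWord : ∀ n f → Inj n f → Bnd n f → ∃ λ vs → RisingFactor n f id vs
sortWord n f = sortBy (inversions n f) f refl
  where
  sortBy : ∀ k f → inversions n f ≡ k → Inj n f → Bnd n f → ∃ λ vs → RisingFactor n f id vs
  sortBy k f eq inj bnd with anyUpTo? (λ a → (suc a <? n) ×-dec (f (suc a) <? f a)) n
  ... | no no-descent = [] , [] , tt , λ x x<n → sym (ascending-id n f ascending bnd x x<n)
    where
    ascending : ∀ a → suc a < n → f a < f (suc a)
    ascending a h with <-cmp (f a) (f (suc a))
    ... | tri< lt _ _ = lt
    ... | tri≈ _ e _  = ⊥-elim (<-irrefl (inj _ _ (<-trans (n<1+n a) h) h e) (n<1+n a))
    ... | tri> _ _ gt = ⊥-elim (no-descent (a , <-trans (n<1+n a) h , h , gt))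
  ... | yes (a , _ , h , desc) = descend k eq
    where
    f′ : ℕ → ℕ
    f′ = f ∘ swap a
    fewer : suc (inversions n f′) ≡ inversions n f
    fewer = begin
      suc (inversions n f′)        ≡⟨ sym (inversions-swap-ascent n a f′ h asc′) ⟩
      inversions n (f′ ∘ swap a)   ≡⟨ inversions-agree n (λ x _ → cong f (swap-involutive a x)) ⟩
      inversions n f               ∎
      where
      open ≡-Reasoning
      asc′ : f′ a < f′ (suc a)
      asc′ rewrite swap-left a | swap-right a = desc
    descend : ∀ k → inversions n f ≡ k → ∃ λ vs → RisingFactor n f id vs
    descend zero    eq′ = ⊥-elim (1+n≢0 (trans fewer eq′))
    descend (suc k) eq′ =
      let vs , fac = sortBy k f′ (suc-injective (trans fewer eq′)) (inj-swap n a f h inj) (bnd-swap n a f h bnd)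
      in vs ++ [ a ] , factor-trans [ a ] vs (factor-descent n f a h desc) fac

word-length-≥ : ∀ n f us → Word n us → Agree n (apply us) f → inversions n f ≤ length us
word-length-≥ n f us v ag = begin
  inversions n f              ≡⟨ inversions-agree n (λ x x<n → sym (ag x x<n)) ⟩
  inversions n (apply us)     ≤⟨ inversions-apply-≤ n id us v ⟩
  inversions n id + length us ≡⟨ cong (_+ length us) (inversions-id n) ⟩
  length us                   ∎
  where open ≤-Reasoning

rising-length : ∀ n f us → RisingFactor n f id us → length us ≡ inversions n f
rising-length n f us (v , r , ag) = begin
  length us                   ≡⟨ cong (_+ length us) (sym (inversions-id n)) ⟩
  inversions n id + length us ≡⟨ sym (rising⇒inversions n id us v r) ⟩
  inversions n (apply us)     ≡⟨ inversions-agree n ag ⟩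
  inversions n f              ∎
  where open ≡-Reasoning

shortest⇒rising : ∀ n f us → Word n us → Agree n (apply us) f → length us ≤ inversions n f →
  RisingFactor n f id us
shortest⇒rising n f us v ag short = v , inversions⇒rising n id us v exact , ag
  where
  open ≡-Reasoning
  exact : inversions n (apply us) ≡ inversions n id + length us
  exact = begin
    inversions n (apply us)     ≡⟨ inversions-agree n ag ⟩
    inversions n f              ≡⟨ ≤-antisym (word-length-≥ n f us v ag) short ⟩
    length us                   ≡⟨ cong (_+ length us) (sym (inversions-id n)) ⟩
    inversions n id + length us ∎

count : ℕ → List ℕ → ℕ
count c = length ∘ filter (_≟ c)

count-++ : ∀ c xs ys → count c (xs ++ ys) ≡ count c xs + count c ys
count-++ c xs ys = trans (cong length (filter-++ (_≟ c) xs ys)) (length-++ (filter (_≟ c) xs))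

count-here : ∀ c xs → count c (c ∷ xs) ≡ suc (count c xs)
count-here c xs = cong length (filter-accept (_≟ c) refl)

count-there : ∀ {c a} xs → a ≢ c → count c (a ∷ xs) ≡ count c xs
count-there xs a≢c = cong length (filter-reject (_≟ _) a≢c)

count≡0⇒free : ∀ c xs → count c xs ≡ 0 → All (_≢ c) xs
count≡0⇒free c []       _ = []
count≡0⇒free c (a ∷ xs) e with a ≟ c
... | yes refl = ⊥-elim (1+n≢0 (trans (sym (count-here c xs)) e))
... | no a≢c   = a≢c ∷ count≡0⇒free c xs (trans (sym (count-there xs a≢c)) e)

free⇒count≡0 : ∀ c {xs} → All (_≢ c) xs → count c xs ≡ 0
free⇒count≡0 c []           = refl
free⇒count≡0 c (a≢c ∷ free) = trans (count-there _ a≢c) (free⇒count≡0 c free)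

lastOccurrence : ∀ c xs → 1 ≤ count c xs → ∃₂ λ α γ → xs ≡ α ++ c ∷ γ × All (_≢ c) γ
lastOccurrence c (a ∷ xs) h with count c xs in eq
... | suc _ = let α , γ , e , free = lastOccurrence c xs (subst (1 ≤_) (sym eq) (s≤s z≤n))
              in a ∷ α , γ , cong (a ∷_) e , free
... | zero with a ≟ c
...   | yes refl = [] , xs , refl , count≡0⇒free c xs eq
...   | no a≢c   = ⊥-elim (<-irrefl (sym (trans (count-there xs a≢c) eq)) h)

lastTwoOccurrences : ∀ c xs → 2 ≤ count c xs →
  Σ (List ℕ) λ α → ∃₂ λ β γ → xs ≡ α ++ c ∷ β ++ c ∷ γ × All (_≢ c) β × All (_≢ c) γ
lastTwoOccurrences c xs two with lastOccurrence c xs (≤-trans (s≤s z≤n) two)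
... | α₀ , γ , refl , free-γ with lastOccurrence c α₀ one
  where
  split : count c (α₀ ++ c ∷ γ) ≡ count c α₀ + 1
  split rewrite count-++ c α₀ (c ∷ γ) | count-here c γ | free⇒count≡0 c free-γ = refl
  one : 1 ≤ count c α₀
  one = +-cancelʳ-≤ 1 1 (count c α₀) (subst (2 ≤_) split two)
... | α , β , refl , free-β = α , β , γ , ++-assoc α (c ∷ β) (c ∷ γ) , free-β , free-γ

apply-keeps-≤ : ∀ c us x → All (_≢ c) us → x ≤ c → apply us x ≤ c
apply-keeps-≤ c []       x []             x≤c = x≤c
apply-keeps-≤ c (a ∷ as) x (a≢c ∷ free) x≤c = swap-keeps-≤ a c _ a≢c (apply-keeps-≤ c as x free x≤c)

apply-keeps-> : ∀ c us x → All (_≢ c) us → c < x → c < apply us x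
apply-keeps-> c []       x []             c<x = c<x
apply-keeps-> c (a ∷ as) x (a≢c ∷ free) c<x = swap-keeps-> a c _ a≢c (apply-keeps-> c as x free c<x)

pullback-keeps-≤ : ∀ c us x → All (_≢ c) us → x ≤ c → pullback us x ≤ c
pullback-keeps-≤ c []       x []             x≤c = x≤c
pullback-keeps-≤ c (a ∷ as) x (a≢c ∷ free) x≤c = pullback-keeps-≤ c as (swap a x) free (swap-keeps-≤ a c x a≢c x≤c)

pullback-keeps-> : ∀ c us x → All (_≢ c) us → c < x → c < pullback us x
pullback-keeps-> c []       x []             c<x = c<x
pullback-keeps-> c (a ∷ as) x (a≢c ∷ free) c<x = pullback-keeps-> c as (swap a x) free (swap-keeps-> a c x a≢c c<x)

injection-≤ : ∀ k m f → Inj k f → (∀ x → x < k → f x < m) → k ≤ m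
injection-≤ k m f inj bnd = injective⇒≤ {f = f′} λ {i} {j} e →
  toℕ-injective (inj _ _ (toℕ<n i) (toℕ<n j)
    (trans (sym (toℕ-fromℕ< (bnd _ (toℕ<n i)))) (trans (cong toℕ e) (toℕ-fromℕ< (bnd _ (toℕ<n j))))))
  where f′ = λ i → fromℕ< (bnd (toℕ i) (toℕ<n i))

large-on-left : ∀ n c P → Inj n P → suc c < n → P c ≤ c → P (suc c) ≤ c → ∃ λ j → j < c × c < P j
large-on-left n c P inj hc Pc≤ Psc≤ with anyUpTo? (λ j → c <? P j) c
... | yes found   = found
... | no no-large = ⊥-elim (<-irrefl refl (injection-≤ (suc (suc c)) (suc c) P inj′ small))
  where
  inj′ : Inj (suc (suc c)) P
  inj′ x y x< y< = inj x y (<-≤-trans x< hc) (<-≤-trans y< hc)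
  small : ∀ x → x < suc (suc c) → P x < suc c
  small x x< with m≤n⇒m<n∨m≡n (≤-pred x<)
  ... | inj₂ refl = s≤s Psc≤
  ... | inj₁ x<sc with m≤n⇒m<n∨m≡n (≤-pred x<sc)
  ...   | inj₂ refl = s≤s Pc≤
  ...   | inj₁ x<c  = s≤s (≮⇒≥ (λ c<Px → no-large (x , x<c , c<Px)))

small-on-right : ∀ n c P → Inj n P → Bnd n P → suc c < n → c < P c → c < P (suc c) →
  ∃ λ j → suc c < j × j < n × P j ≤ c
small-on-right n c P inj bnd hc c<Pc c<Psc with anyUpTo? (λ j → (suc c <? j) ×-dec (P j ≤? c)) n
... | yes (j , j<n , sc<j , Pj≤) = j , sc<j , j<n , Pj≤
... | no no-small = ⊥-elim (<-irrefl refl (injection-≤ (suc m) m g inj′ g<m))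
  where
  m : ℕ
  m = n ∸ suc c
  -- g y = P (c + y) − (c + 1) is injective from [0, m+1) into [0, m)
  large : ∀ x → c ≤ x → x < n → c < P x
  large x c≤x x<n with m≤n⇒m<n∨m≡n c≤x
  ... | inj₂ refl = c<Pc
  ... | inj₁ c<x with m≤n⇒m<n∨m≡n c<x
  ...   | inj₂ refl = c<Psc
  ...   | inj₁ sc<x = ≰⇒> (λ Px≤ → no-small (x , x<n , sc<x , Px≤))
  in-range : ∀ y → y < suc m → c + y < n
  in-range y y< = subst (c + y <_) (m+[n∸m]≡n (<⇒≤ hc)) (s≤s (+-monoʳ-≤ c (≤-pred y<)))
  g : ℕ → ℕ
  g y = P (c + y) ∸ suc c
  g<m : ∀ y → y < suc m → g y < m
  g<m y y< = ∸-monoˡ-< (bnd _ (in-range y y<)) (large (c + y) (m≤m+n c y) (in-range y y<))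
  restore : ∀ y → y < suc m → g y + suc c ≡ P (c + y)
  restore y y< = m∸n+n≡m (large (c + y) (m≤m+n c y) (in-range y y<))
  inj′ : Inj (suc m) g
  inj′ x y x< y< e = +-cancelˡ-≡ c x y (inj _ _ (in-range x x<) (in-range y y<)
    (trans (sym (restore x x<)) (trans (cong (_+ suc c) e) (restore y y<))))

-- The patterns of the theorem in the 0-based model: the cut between the
-- positions (and values) c and c+1 plays the role of k = c+1.
Has321 : ℕ → (ℕ → ℕ) → ℕ → Set
Has321 n W c = Σ ℕ λ r₁ → Σ ℕ λ r₂ → Σ ℕ λ r₃ → r₃ < n × r₁ < r₂ × r₂ < r₃ ×
  W r₂ < W r₁ × W r₃ < W r₂ × r₁ ≤ c × c < r₃ × W r₃ ≤ c × c < W r₁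

Has3412 : ℕ → (ℕ → ℕ) → ℕ → Set
Has3412 n W c = Σ ℕ λ r₁ → Σ ℕ λ r₂ → Σ ℕ λ r₃ → Σ ℕ λ r₄ → r₄ < n × r₁ < r₂ × r₂ < r₃ × r₃ < r₄ ×
  W r₃ < W r₄ × W r₄ < W r₁ × W r₁ < W r₂ × r₂ ≤ c × c < r₃ × W r₄ ≤ c × c < W r₁

Straddling : ℕ → (ℕ → ℕ) → ℕ → Set
Straddling n W c = Has321 n W c ⊎ Has3412 n W c

LeftCrosser : ℕ → (ℕ → ℕ) → ℕ → Set
LeftCrosser c W p = p ≤ c × c < W p

RightCrosser : ℕ → ℕ → (ℕ → ℕ) → ℕ → Set
RightCrosser n c W q = c < q × q < n × W q ≤ c

-- Two crossers on each side always form a straddling 321 or 3412: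
-- compare the two left values and the two right values.
ordered-crossers⇒straddling : ∀ {n c W p₁ p₂ q₁ q₂} → Inj n W → c < n → p₁ < p₂ → q₁ < q₂ →
  LeftCrosser c W p₁ → LeftCrosser c W p₂ → RightCrosser n c W q₁ → RightCrosser n c W q₂ →
  Straddling n W c
ordered-crossers⇒straddling {n} {c} {W} {p₁} {p₂} {q₁} {q₂} inj c<n p₁<p₂ q₁<q₂
  (p₁≤ , b₁) (p₂≤ , b₂) (c<q₁ , q₁<n , s₁) (c<q₂ , q₂<n , s₂)
  with <-cmp (W p₁) (W p₂) | <-cmp (W q₁) (W q₂)
... | tri≈ _ e _ | _ = ⊥-elim (<-irrefl (inj _ _ (<-trans p₁<p₂ p₂<n) p₂<n e) p₁<p₂)
  where p₂<n = ≤-<-trans p₂≤ c<n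
... | _ | tri≈ _ e _ = ⊥-elim (<-irrefl (inj _ _ q₁<n q₂<n e) q₁<q₂)
... | tri> _ _ gt | _ = inj₁ (p₁ , p₂ , q₁ , q₁<n , p₁<p₂ , ≤-<-trans p₂≤ c<q₁ , gt ,
        ≤-<-trans s₁ b₂ , <⇒≤ (<-≤-trans p₁<p₂ p₂≤) , c<q₁ , s₁ , b₁)
... | tri< _ _ _ | tri> _ _ gt = inj₁ (p₁ , q₁ , q₂ , q₂<n , <-≤-trans p₁<p₂ (<⇒≤ (≤-<-trans p₂≤ c<q₁)) ,
        q₁<q₂ , ≤-<-trans s₁ b₁ , gt , <⇒≤ (<-≤-trans p₁<p₂ p₂≤) , c<q₂ , s₂ , b₁)
... | tri< lt _ _ | tri< lt′ _ _ = inj₂ (p₁ , p₂ , q₁ , q₂ , q₂<n , p₁<p₂ , ≤-<-trans p₂≤ c<q₁ , q₁<q₂ ,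
        lt′ , ≤-<-trans s₂ b₁ , lt , p₂≤ , c<q₁ , s₂ , b₁)

crossers⇒straddling : ∀ {n c W p₁ p₂ q₁ q₂} → Inj n W → c < n → p₁ ≢ p₂ → q₁ ≢ q₂ →
  LeftCrosser c W p₁ → LeftCrosser c W p₂ → RightCrosser n c W q₁ → RightCrosser n c W q₂ →
  Straddling n W c
crossers⇒straddling {p₁ = p₁} {p₂} {q₁} {q₂} inj c<n p₁≢p₂ q₁≢q₂ l₁ l₂ r₁ r₂
  with <-cmp p₁ p₂ | <-cmp q₁ q₂
... | tri≈ _ e _ | _          = ⊥-elim (p₁≢p₂ e)
... | _          | tri≈ _ e _ = ⊥-elim (q₁≢q₂ e)
... | tri< p< _ _ | tri< q< _ _ = ordered-crossers⇒straddling inj c<n p< q< l₁ l₂ r₁ r₂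
... | tri< p< _ _ | tri> _ _ q> = ordered-crossers⇒straddling inj c<n p< q> l₁ l₂ r₂ r₁
... | tri> _ _ p> | tri< q< _ _ = ordered-crossers⇒straddling inj c<n p> q< l₂ l₁ r₁ r₂
... | tri> _ _ p> | tri> _ _ q> = ordered-crossers⇒straddling inj c<n p> q> l₂ l₁ r₂ r₁

KeepsCrossers : ℕ → ℕ → (ℕ → ℕ) → (ℕ → ℕ) → Set
KeepsCrossers n c P t = (∀ z → LeftCrosser c P z → t z ≤ c) × (∀ z → RightCrosser n c P z → c < t z)

free-keeps-crossers : ∀ {n c P} us → All (_≢ c) us → KeepsCrossers n c P (pullback us)
free-keeps-crossers {c = c} us free =
  (λ z (z≤c , _) → pullback-keeps-≤ c us z free z≤c) , (λ z (c<z , _) → pullback-keeps-> c us z free c<z)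

transport321 : ∀ {n c W P us} → RisingFactor n W P us → KeepsCrossers n c P (pullback us) →
  Has321 n P c → Has321 n W c
transport321 {n} {c} {W} {P} {us} fac@(v , r , _) (keepL , keepR)
  (r₁ , r₂ , r₃ , r₃<n , r₁<r₂ , r₂<r₃ , P₂<P₁ , P₃<P₂ , r₁≤c , c<r₃ , P₃≤c , c<P₁) =
  t r₁ , t r₂ , t r₃ , pullback-< us r₃ v r₃<n ,
  pullback-order P us r₁ r₂ r r₁<r₂ P₂<P₁ , pullback-order P us r₂ r₃ r r₂<r₃ P₃<P₂ ,
  subst₂ _<_ (sym (value r₂ r₂<n)) (sym (value r₁ r₁<n)) P₂<P₁ ,
  subst₂ _<_ (sym (value r₃ r₃<n)) (sym (value r₂ r₂<n)) P₃<P₂ ,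
  keepL r₁ (r₁≤c , c<P₁) , keepR r₃ (c<r₃ , r₃<n , P₃≤c) ,
  subst (_≤ c) (sym (value r₃ r₃<n)) P₃≤c , subst (c <_) (sym (value r₁ r₁<n)) c<P₁
  where
  t : ℕ → ℕ
  t = pullback us
  value = factor-pullback fac
  r₂<n = <-trans r₂<r₃ r₃<n
  r₁<n = <-trans r₁<r₂ r₂<n

data AscentShape (c : ℕ) (q : ℕ → ℕ) : Set where
  same-side : q (suc c) ≤ c ⊎ c < q c → AscentShape c q
  crossing  : q c ≤ c → c < q (suc c) → AscentShape c q

ascentShape : ∀ c q → AscentShape c q
ascentShape c q with q (suc c) ≤? c | c <? q c
... | yes small | _       = same-side (inj₁ small)
... | no _      | yes big = same-side (inj₂ big)
... | no ¬small | no ¬big = crossing (≮⇒≥ ¬big) (≰⇒> ¬small)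

-- Swapping an ascent whose values lie on the same side of the cut creates a
-- straddling 321 (the third entry is supplied by the pigeonhole principle).
same-side-321 : ∀ n c q → Inj n q → Bnd n q → suc c < n → q c < q (suc c) →
  q (suc c) ≤ c ⊎ c < q c → Has321 n (q ∘ swap c) c
same-side-321 n c q inj bnd hc asc = build
  where
  at-c : q (swap c c) ≡ q (suc c)
  at-c = cong q (swap-left c)
  at-sc : q (swap c (suc c)) ≡ q c
  at-sc = cong q (swap-right c)
  at-other : ∀ j → j ≢ c → j ≢ suc c → q (swap c j) ≡ q j
  at-other j j≢c j≢sc = cong q (swap-fixed c j j≢c j≢sc)
  build : q (suc c) ≤ c ⊎ c < q c → Has321 n (q ∘ swap c) c
  build (inj₁ small) with j , j<c , c<qj ← large-on-left n c q inj hc (<⇒≤ (<-≤-trans asc small)) small =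
    j , c , suc c , hc , j<c , n<1+n c ,
    subst₂ _<_ (sym at-c) (sym at-j) (≤-<-trans small c<qj) , subst₂ _<_ (sym at-sc) (sym at-c) asc ,
    <⇒≤ j<c , n<1+n c , subst (_≤ c) (sym at-sc) (<⇒≤ (<-≤-trans asc small)) , subst (c <_) (sym at-j) c<qj
    where at-j = at-other j (<⇒≢ j<c) (<⇒≢ (<-trans j<c (n<1+n c)))
  build (inj₂ big) with j , sc<j , j<n , qj≤ ← small-on-right n c q inj bnd hc big (<-trans big asc) =
    c , suc c , j , j<n , n<1+n c , sc<j ,
    subst₂ _<_ (sym at-sc) (sym at-c) asc , subst₂ _<_ (sym at-j) (sym at-sc) (≤-<-trans qj≤ big) ,
    ≤-refl , <-trans (n<1+n c) sc<j , subst (_≤ c) (sym at-j) qj≤ , subst (c <_) (sym at-c) (<-trans big asc)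
    where at-j = at-other j (>⇒≢ (<-trans (n<1+n c) sc<j)) (>⇒≢ sc<j)

-- In W = P ∘ apply (β ++ c ∷ γ) with β, γ avoiding c, the letter c swaps the
-- values P (apply β c) and P (apply β (c+1)); if these lie on different
-- sides of the cut, no crosser of P is moved across it.
crossing-swap-keeps : ∀ n c P β γ → All (_≢ c) β → All (_≢ c) γ →
  P (apply β c) ≤ c → c < P (apply β (suc c)) → KeepsCrossers n c P (pullback (β ++ c ∷ γ))
crossing-swap-keeps n c P β γ free-β free-γ small big = keepL , keepR
  where
  value : ∀ z → P (apply β (pullback β z)) ≡ P z
  value z = cong P (apply-pullback β z)
  keepL : ∀ z → LeftCrosser c P z → pullback (β ++ c ∷ γ) z ≤ c
  keepL z (z≤c , c<Pz) =
    subst (_≤ c) (sym (trans (pullback-++ β (c ∷ γ) z) (cong (pullback γ) fixed)))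
      (pullback-keeps-≤ c γ _ free-γ y≤c)
    where
    y≤c = pullback-keeps-≤ c β z free-β z≤c
    y≢c : pullback β z ≢ c
    y≢c e = <⇒≱ (subst (c <_) (trans (sym (value z)) (cong (P ∘ apply β) e)) c<Pz) small
    fixed = swap-fixed c (pullback β z) y≢c (<⇒≢ (s≤s y≤c))
  keepR : ∀ z → RightCrosser n c P z → c < pullback (β ++ c ∷ γ) z
  keepR z (c<z , _ , Pz≤c) =
    subst (c <_) (sym (trans (pullback-++ β (c ∷ γ) z) (cong (pullback γ) fixed)))
      (pullback-keeps-> c γ _ free-γ c<y)
    where
    c<y = pullback-keeps-> c β z free-β c<z
    y≢sc : pullback β z ≢ suc c
    y≢sc e = <⇒≱ big (subst (_≤ c) (trans (sym (value z)) (cong (P ∘ apply β) e)) Pz≤c)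
    fixed = swap-fixed c (pullback β z) (>⇒≢ c<y) y≢sc

-- If both letters c of W = P ∘ apply (β ++ c ∷ γ) swap a small with a large
-- value, the four positions they touch give two crossers on each side of
-- the cut in W.
double-crossing : ∀ {n c W P} β γ → suc c < n → Inj n W → RisingFactor n W P (β ++ c ∷ γ) →
  All (_≢ c) β → All (_≢ c) γ → P (suc c) ≤ c → c < P c →
  P (apply β c) ≤ c → c < P (apply β (suc c)) → Straddling n W c
double-crossing {n} {c} {W} {P} β γ hc injW fac@(v , _ , _) free-β free-γ Psc≤ c<Pc small big =
  crossers⇒straddling injW c<n distinct-left distinct-right
    (keepL c (≤-refl , c<Pc) , subst (c <_) (sym (valueU c c<n)) c<Pc)
    (pullback-keeps-≤ c γ c free-γ ≤-refl , subst (c <_) (sym (trans (valueG c c<n) (cong (P ∘ apply β) (swap-left c)))) big)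
    (keepR (suc c) (n<1+n c , hc , Psc≤) , pullback-< (β ++ c ∷ γ) (suc c) v hc ,
      subst (_≤ c) (sym (valueU (suc c) hc)) Psc≤)
    (pullback-keeps-> c γ (suc c) free-γ (n<1+n c) , pullback-< γ (suc c) (proj₁ facG) hc ,
      subst (_≤ c) (sym (trans (valueG (suc c) hc) (cong (P ∘ apply β) (swap-right c)))) small)
  where
  facG : RisingFactor n W (P ∘ apply β ∘ swap c) γ
  facG = factor-++⁻ {g = P ∘ apply β} [ c ] γ (factor-++⁻ {g = P} β (c ∷ γ) fac)
  c<n = <-trans (n<1+n c) hc
  valueU = factor-pullback fac
  valueG = factor-pullback facG
  keepL = proj₁ (crossing-swap-keeps n c P β γ free-β free-γ small big)
  keepR = proj₂ (crossing-swap-keeps n c P β γ free-β free-γ small big)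
  -- the position pulled back through β ++ c ∷ γ differs from the one
  -- pulled back through γ alone, since β cannot move z across the cut
  through-c : ∀ z → pullback (β ++ c ∷ γ) z ≡ pullback γ z → pullback β z ≡ swap c z
  through-c z e = swap-injective c (trans (pullback-injective γ (trans (sym (pullback-++ β (c ∷ γ) z)) e))
                                          (sym (swap-involutive c z)))
  distinct-left : pullback (β ++ c ∷ γ) c ≢ pullback γ c
  distinct-left e = <⇒≱ (n<1+n c)
    (subst (_≤ c) (trans (through-c c e) (swap-left c)) (pullback-keeps-≤ c β c free-β ≤-refl))
  distinct-right : pullback (β ++ c ∷ γ) (suc c) ≢ pullback γ (suc c)
  distinct-right e = <-irrefl (sym (trans (through-c (suc c) e) (swap-right c)))
    (pullback-keeps-> c β (suc c) free-β (n<1+n c))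

head-ascent : ∀ {n f g a us} → RisingFactor n f g (a ∷ us) → g a < g (suc a)
head-ascent (_ , (asc , _) , _) = asc

-- Look at the values exchanged by
-- the last swap at c, then (if they cross) at those exchanged by the first.
forward-core : ∀ {n c W p} β γ → suc c < n → Inj n W → Bnd n W →
  RisingFactor n W p (c ∷ β ++ c ∷ γ) → All (_≢ c) β → All (_≢ c) γ → Straddling n W c
forward-core {n} {c} {W} {p} β γ hc injW bndW fac free-β free-γ = byLastSwap (ascentShape c P₂)
  where
  P₁ P₂ : ℕ → ℕ
  P₁ = p ∘ swap c
  P₂ = P₁ ∘ apply β
  fac₁ : RisingFactor n W P₁ (β ++ c ∷ γ)
  fac₁ = factor-++⁻ {g = p} [ c ] (β ++ c ∷ γ) fac
  fac₂ : RisingFactor n W P₂ (c ∷ γ)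
  fac₂ = factor-++⁻ {g = P₁} β (c ∷ γ) fac₁
  fac₃ : RisingFactor n W (P₂ ∘ swap c) γ
  fac₃ = factor-++⁻ {g = P₂} [ c ] γ fac₂
  byFirstSwap : P₂ c ≤ c → c < P₂ (suc c) → AscentShape c p → Straddling n W c
  byFirstSwap small big (same-side s) =
    inj₁ (transport321 fac₁ (crossing-swap-keeps n c P₁ β γ free-β free-γ small big)
      (same-side-321 n c p (factor-inj {g = p} fac injW) (factor-bnd {g = p} fac bndW) hc (head-ascent {g = p} fac) s))
  byFirstSwap small big (crossing pc≤ c<psc) =
    double-crossing {P = P₁} β γ hc injW fac₁ free-β free-γ
      (subst (_≤ c) (sym (cong p (swap-right c))) pc≤) (subst (c <_) (sym (cong p (swap-left c))) c<psc) small big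
  byLastSwap : AscentShape c P₂ → Straddling n W c
  byLastSwap (same-side s) =
    inj₁ (transport321 fac₃ (free-keeps-crossers γ free-γ)
      (same-side-321 n c P₂ (factor-inj {g = P₂} fac₂ injW) (factor-bnd {g = P₂} fac₂ bndW) hc (head-ascent {g = P₂} fac₂) s))
  byLastSwap (crossing small big) = byFirstSwap small big (ascentShape c p)

forward : ∀ n c W as → suc c < n → Inj n W → Bnd n W → RisingFactor n W id as → 2 ≤ count c as →
  Straddling n W c
forward n c W as hc inj bnd fac two with α , β , γ , refl , free-β , free-γ ← lastTwoOccurrences c as two =
  forward-core {p = apply α} β γ hc inj bnd (factor-++⁻ {g = id} α (c ∷ β ++ c ∷ γ) fac) free-β free-γ

carry-large : ∀ n c f j t → j ≤ c → suc c < n → t < f j →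
  ∃₂ λ g us → RisingFactor n f g us × t < g c × (∀ x → x < n → x < j ⊎ c < x → g x ≡ f x)
carry-large n c f j t j≤c hc t<fj = go (c ∸ j) f j (m+[n∸m]≡n j≤c) t<fj
  where
  go : ∀ d f j → j + d ≡ c → t < f j →
    ∃₂ λ g us → RisingFactor n f g us × t < g c × (∀ x → x < n → x < j ⊎ c < x → g x ≡ f x)
  go zero f j e t<fj rewrite +-identityʳ j | e = f , [] , factor-refl n f , t<fj , λ _ _ _ → refl
  go (suc d) f j e t<fj with f (suc j) <? f j
  ... | yes desc =
    let g , us , fac , big , fixed = go d (f ∘ swap j) (suc j) e′ (subst (λ y → t < f y) (sym (swap-right j)) t<fj)
    in g , us ++ [ j ] , factor-trans {g = f ∘ swap j} [ j ] us (factor-descent n f j hj desc) fac , big , fixed′ {g} fixed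
    where
    e′  = trans (sym (+-suc j d)) e
    sj≤c : suc j ≤ c
    sj≤c = subst (suc j ≤_) e′ (m≤m+n (suc j) d)
    hj : suc j < n
    hj = <-trans (s≤s sj≤c) hc
    fixed′ : ∀ {g} → (∀ x → x < n → x < suc j ⊎ c < x → g x ≡ f (swap j x)) →
      ∀ x → x < n → x < j ⊎ c < x → g x ≡ f x
    fixed′ fixed x x<n (inj₁ x<j) = trans (fixed x x<n (inj₁ (<-trans x<j (n<1+n j))))
      (cong f (swap-fixed j x (<⇒≢ x<j) (<⇒≢ (<-trans x<j (n<1+n j)))))
    fixed′ fixed x x<n (inj₂ c<x) = trans (fixed x x<n (inj₂ c<x))
      (cong f (swap-fixed j x (>⇒≢ (<-≤-trans (n<1+n j) (≤-trans sj≤c (<⇒≤ c<x)))) (>⇒≢ (≤-<-trans sj≤c c<x))))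
  ... | no ¬desc =
    let g , us , fac , big , fixed = go d f (suc j) (trans (sym (+-suc j d)) e) (<-≤-trans t<fj (≮⇒≥ ¬desc))
    in g , us , fac , big , λ { x x<n (inj₁ x<j) → fixed x x<n (inj₁ (<-trans x<j (n<1+n j)))
                              ; x x<n (inj₂ c<x) → fixed x x<n (inj₂ c<x) }

carry-small : ∀ n c f j t → c < j → j < n → f j < t →
  ∃₂ λ g us → RisingFactor n f g us × g (suc c) < t × (∀ x → x < n → x ≤ c ⊎ j < x → g x ≡ f x)
carry-small n c f j t c<j j<n fj<t = go (j ∸ suc c) f j (m+[n∸m]≡n c<j) j<n fj<t
  where
  go : ∀ d f j → suc c + d ≡ j → j < n → f j < t →
    ∃₂ λ g us → RisingFactor n f g us × g (suc c) < t × (∀ x → x < n → x ≤ c ⊎ j < x → g x ≡ f x)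
  go zero f j e j<n fj<t rewrite +-identityʳ c | sym e = f , [] , factor-refl n f , fj<t , λ _ _ _ → refl
  go (suc d) f zero () j<n fj<t
  go (suc d) f (suc j) e j<n fj<t with f (suc j) <? f j
  ... | yes desc =
    let g , us , fac , small , fixed = go d (f ∘ swap j) j e′ (<-trans (n<1+n j) j<n)
                                          (subst (λ y → f y < t) (sym (swap-left j)) fj<t)
    in g , us ++ [ j ] , factor-trans {g = f ∘ swap j} [ j ] us (factor-descent n f j j<n desc) fac ,
       small , fixed′ {g} fixed
    where
    e′ = suc-injective (trans (sym (+-suc (suc c) d)) e)
    sc≤j : suc c ≤ j
    sc≤j = subst (suc c ≤_) e′ (m≤m+n (suc c) d)
    fixed′ : ∀ {g} → (∀ x → x < n → x ≤ c ⊎ j < x → g x ≡ f (swap j x)) →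
      ∀ x → x < n → x ≤ c ⊎ suc j < x → g x ≡ f x
    fixed′ fixed x x<n (inj₁ x≤c) = trans (fixed x x<n (inj₁ x≤c))
      (cong f (swap-fixed j x (<⇒≢ (≤-<-trans x≤c sc≤j)) (<⇒≢ (<-trans (≤-<-trans x≤c sc≤j) (n<1+n j)))))
    fixed′ fixed x x<n (inj₂ sj<x) = trans (fixed x x<n (inj₂ (<-trans (n<1+n j) sj<x)))
      (cong f (swap-fixed j x (>⇒≢ (<-trans (n<1+n j) sj<x)) (>⇒≢ sj<x)))
  ... | no ¬desc =
    let g , us , fac , small , fixed = go d f j (suc-injective (trans (sym (+-suc (suc c) d)) e))
                                          (<-trans (n<1+n j) j<n) (≤-<-trans (≮⇒≥ ¬desc) fj<t)
    in g , us , fac , small , λ { x x<n (inj₁ x≤c) → fixed x x<n (inj₁ x≤c)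
                                ; x x<n (inj₂ sj<x) → fixed x x<n (inj₂ (<-trans (n<1+n j) sj<x)) }

-- An inversion jb ≤ c < ja of W can be brought to the positions (c, c+1) and
-- then swapped away: W = g ∘ apply us with us rising from g and containing
-- the letter c, where g agrees with W outside [jb, ja].
split-off-c : ∀ n c W jb ja → jb ≤ c → c < ja → ja < n → W ja < W jb →
  ∃₂ λ g us → RisingFactor n W g us × 1 ≤ count c us × (∀ x → x < n → x < jb ⊎ ja < x → g x ≡ W x)
split-off-c n c W jb ja jb≤c c<ja ja<n inv
  with g₁ , us₁ , fac₁ , big , fixed₁ ← carry-large n c W jb (W ja) jb≤c (≤-<-trans c<ja ja<n) inv
  with g₂ , us₂ , fac₂ , small , fixed₂ ← carry-small n c g₁ ja (g₁ c) c<ja ja<n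
                                            (subst (_< g₁ c) (sym (fixed₁ ja ja<n (inj₂ c<ja))) big) =
  g₂ ∘ swap c , c ∷ us₂ ++ us₁ ,
  factor-trans {g = g₂} {h = g₂ ∘ swap c} (us₂ ++ us₁) [ c ]
    (factor-trans {g = g₁} us₁ us₂ fac₁ fac₂) (factor-descent n g₂ c hc descent) ,
  subst (1 ≤_) (sym (count-here c (us₂ ++ us₁))) (s≤s z≤n) ,
  fixed
  where
  hc : suc c < n
  hc = ≤-<-trans c<ja ja<n
  descent : g₂ (suc c) < g₂ c
  descent = subst (g₂ (suc c) <_) (sym (fixed₂ c (<-trans (n<1+n c) hc) (inj₁ ≤-refl))) small
  fixed : ∀ x → x < n → x < jb ⊎ ja < x → g₂ (swap c x) ≡ W x
  fixed x x<n (inj₁ x<jb) = begin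
    g₂ (swap c x) ≡⟨ cong g₂ (swap-fixed c x (<⇒≢ x<c) (<⇒≢ (<-trans x<c (n<1+n c)))) ⟩
    g₂ x          ≡⟨ fixed₂ x x<n (inj₁ (<⇒≤ x<c)) ⟩
    g₁ x          ≡⟨ fixed₁ x x<n (inj₁ x<jb) ⟩
    W x           ∎
    where
    open ≡-Reasoning
    x<c = <-≤-trans x<jb jb≤c
  fixed x x<n (inj₂ ja<x) = begin
    g₂ (swap c x) ≡⟨ cong g₂ (swap-fixed c x (>⇒≢ c<x) (>⇒≢ (≤-<-trans c<ja ja<x))) ⟩
    g₂ x          ≡⟨ fixed₂ x x<n (inj₂ ja<x) ⟩
    g₁ x          ≡⟨ fixed₁ x x<n (inj₂ c<x) ⟩
    W x           ∎
    where
    open ≡-Reasoning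
    c<x = <-trans c<ja ja<x

Crosser : ℕ → ℕ → (ℕ → ℕ) → ℕ → Set
Crosser n c g i = LeftCrosser c g i ⊎ RightCrosser n c g i

crosser-needs-c : ∀ n c g vs i → c < n → Agree n (apply vs) g → Crosser n c g i → 1 ≤ count c vs
crosser-needs-c n c g vs i c<n ag crosser with count c vs in eq
... | suc _ = s≤s z≤n
... | zero with crosser
...   | inj₁ (i≤c , c<gi) =
  ⊥-elim (<⇒≱ c<gi (subst (_≤ c) (ag i (≤-<-trans i≤c c<n)) (apply-keeps-≤ c vs i (count≡0⇒free c vs eq) i≤c)))
...   | inj₂ (c<i , i<n , gi≤c) =
  ⊥-elim (<⇒≱ (subst (c <_) (ag i i<n) (apply-keeps-> c vs i (count≡0⇒free c vs eq) c<i)) gi≤c)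

TwoLetters : ℕ → ℕ → (ℕ → ℕ) → Set
TwoLetters n c W = ∃ λ as → RisingFactor n W id as × 2 ≤ count c as

two-letters : ∀ n c W g us i → c < n → Inj n W → Bnd n W → RisingFactor n W g us → 1 ≤ count c us →
  Crosser n c g i → TwoLetters n c W
two-letters n c W g us i c<n inj bnd fac one crosser
  with vs , sorted ← sortWord n g (factor-inj {g = g} fac inj) (factor-bnd {g = g} fac bnd) =
  vs ++ us , factor-trans {g = g} us vs fac sorted ,
  subst (2 ≤_) (sym (count-++ c vs us)) (+-mono-≤ (crosser-needs-c n c g vs i c<n (proj₂ (proj₂ sorted)) crosser) one)

backward : ∀ n c W → c < n → Inj n W → Bnd n W → Straddling n W c → TwoLetters n c W
backward n c W c<n inj bnd (inj₁ (r₁ , r₂ , r₃ , r₃<n , r₁<r₂ , r₂<r₃ , W₂<W₁ , W₃<W₂ , r₁≤c , c<r₃ , W₃≤c , c<W₁))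
  with r₂ ≤? c
... | yes r₂≤c with g , us , fac , one , fixed ← split-off-c n c W r₂ r₃ r₂≤c c<r₃ r₃<n W₃<W₂ =
  two-letters n c W g us r₁ c<n inj bnd fac one
    (inj₁ (r₁≤c , subst (c <_) (sym (fixed r₁ (<-trans r₁<r₂ (<-trans r₂<r₃ r₃<n)) (inj₁ r₁<r₂))) c<W₁))
... | no r₂≰c
  with g , us , fac , one , fixed ← split-off-c n c W r₁ r₂ r₁≤c (≰⇒> r₂≰c) (<-trans r₂<r₃ r₃<n) W₂<W₁ =
  two-letters n c W g us r₃ c<n inj bnd fac one
    (inj₂ (c<r₃ , r₃<n , subst (_≤ c) (sym (fixed r₃ r₃<n (inj₂ r₂<r₃))) W₃≤c))
backward n c W c<n inj bnd
  (inj₂ (r₁ , r₂ , r₃ , r₄ , r₄<n , r₁<r₂ , r₂<r₃ , r₃<r₄ , W₃<W₄ , W₄<W₁ , W₁<W₂ , r₂≤c , c<r₃ , W₄≤c , c<W₁))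
  with g , us , fac , one , fixed ← split-off-c n c W r₂ r₃ r₂≤c c<r₃ (<-trans r₃<r₄ r₄<n)
                                       (<-trans W₃<W₄ (<-trans W₄<W₁ W₁<W₂)) =
  two-letters n c W g us r₁ c<n inj bnd fac one
    (inj₁ (<⇒≤ (<-≤-trans r₁<r₂ r₂≤c) ,
           subst (c <_) (sym (fixed r₁ (<-trans r₁<r₂ (<-trans r₂<r₃ (<-trans r₃<r₄ r₄<n))) (inj₁ r₁<r₂))) c<W₁))

transpose-swap : ∀ {n} (a b y : Fin n) → toℕ b ≡ suc (toℕ a) → toℕ (transpose a b y) ≡ swap (toℕ a) (toℕ y)
transpose-swap a b y b≡sa with y Fin.≟ a
... | yes refl = trans b≡sa (sym (swap-left (toℕ a)))
... | no y≢a with y Fin.≟ b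
...   | yes refl = sym (trans (cong (swap (toℕ a)) b≡sa) (swap-right (toℕ a)))
...   | no y≢b = sym (swap-fixed (toℕ a) (toℕ y) (y≢a ∘ toℕ-injective)
                                 (y≢b ∘ toℕ-injective ∘ (λ e → trans e (sym b≡sa))))

indices : ∀ {n} → List (Letter n) → List ℕ
indices = map (toℕ ∘ proj₁)

indices-word : ∀ {n} (ws : List (Letter n)) → Word n (indices ws)
indices-word []             = []
indices-word ((_ , h) ∷ ws) = h ∷ indices-word ws

⟦⟧-apply : ∀ {n} (ws : List (Letter n)) (i : Fin n) → toℕ (⟦ ws ⟧ i) ≡ apply (indices ws) (toℕ i)
⟦⟧-apply []             i = refl
⟦⟧-apply ((a , h) ∷ ws) i =
  trans (transpose-swap a (fromℕ< h) (⟦ ws ⟧ i) (toℕ-fromℕ< h)) (cong (swap (toℕ a)) (⟦⟧-apply ws i))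

letters : ∀ {n} as → Word n as → List (Letter n)
letters []       []      = []
letters (a ∷ as) (h ∷ v) = (fromℕ< (<-trans (n<1+n a) h) , subst (λ x → suc x < _) (sym (toℕ-fromℕ< _)) h) ∷ letters as v

indices-letters : ∀ {n} as (v : Word n as) → indices (letters as v) ≡ as
indices-letters []       []      = refl
indices-letters (a ∷ as) (h ∷ v) = cong₂ _∷_ (toℕ-fromℕ< _) (indices-letters as v)

length-letters : ∀ {n} as (v : Word n as) → length (letters as v) ≡ length as
length-letters as v = trans (sym (length-map (toℕ ∘ proj₁) (letters as v))) (cong length (indices-letters as v))

occurrences-count : ∀ {n} c (ws : List (Letter n)) → occurrences (suc c) ws ≡ count c (indices ws)
occurrences-count c [] = refl
occurrences-count c ((a , h) ∷ ws) with toℕ a ≟ c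
... | yes a≡c = trans (cong length (filter-accept (λ l → index l ≟ suc c) (cong suc a≡c)))
                  (trans (cong suc (occurrences-count c ws))
                         (sym (trans (cong (λ x → count c (x ∷ indices ws)) a≡c) (count-here c (indices ws)))))
... | no a≢c  = trans (cong length (filter-reject (λ l → index l ≟ suc c) (a≢c ∘ suc-injective)))
                  (trans (occurrences-count c ws) (sym (count-there (indices ws) a≢c)))

occurrences-letters : ∀ {n} c as (v : Word n as) → occurrences (suc c) (letters as v) ≡ count c as
occurrences-letters c as v = trans (occurrences-count c (letters as v)) (cong (count c) (indices-letters as v))

-- A permutation w of Fin n seen as a function ℕ → ℕ (extended by 0).
module Model {n : ℕ} (w : Permutation′ n) where

  Wf : ℕ → ℕ
  Wf x with x <? n
  ... | yes x<n = toℕ (w ⟨$⟩ʳ fromℕ< x<n)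
  ... | no _    = 0

  Wf-fromℕ< : ∀ x (x<n : x < n) → Wf x ≡ toℕ (w ⟨$⟩ʳ fromℕ< x<n)
  Wf-fromℕ< x x<n with x <? n
  ... | yes _    = refl
  ... | no  x≮n  = ⊥-elim (x≮n x<n)

  Wf-toℕ : ∀ i → Wf (toℕ i) ≡ toℕ (w ⟨$⟩ʳ i)
  Wf-toℕ i = trans (Wf-fromℕ< (toℕ i) (toℕ<n i)) (cong (λ j → toℕ (w ⟨$⟩ʳ j)) (fromℕ<-toℕ i (toℕ<n i)))

  Wf-inj : Inj n Wf
  Wf-inj x y x<n y<n e = fromℕ<-injective x y x<n y<n (begin
    fromℕ< x<n                          ≡⟨ sym (inverseˡ w) ⟩
    w ⟨$⟩ˡ (w ⟨$⟩ʳ fromℕ< x<n)          ≡⟨ cong (w ⟨$⟩ˡ_) (toℕ-injective same-value) ⟩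
    w ⟨$⟩ˡ (w ⟨$⟩ʳ fromℕ< y<n)          ≡⟨ inverseˡ w ⟩
    fromℕ< y<n                          ∎)
    where
    open ≡-Reasoning
    same-value : toℕ (w ⟨$⟩ʳ fromℕ< x<n) ≡ toℕ (w ⟨$⟩ʳ fromℕ< y<n)
    same-value = trans (sym (Wf-fromℕ< x x<n)) (trans e (Wf-fromℕ< y y<n))

  Wf-bnd : Bnd n Wf
  Wf-bnd x x<n = subst (_< n) (sym (Wf-fromℕ< x x<n)) (toℕ<n _)

  decomposition⇒agree : ∀ ws → IsDecomposition w ws → Agree n (apply (indices ws)) Wf
  decomposition⇒agree ws dec x x<n = begin
    apply (indices ws) x                       ≡⟨ cong (apply (indices ws)) (sym (toℕ-fromℕ< x<n)) ⟩
    apply (indices ws) (toℕ (fromℕ< x<n))     ≡⟨ sym (⟦⟧-apply ws (fromℕ< x<n)) ⟩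
    toℕ (⟦ ws ⟧ (fromℕ< x<n))                 ≡⟨ cong toℕ (dec (fromℕ< x<n)) ⟩
    toℕ (w ⟨$⟩ʳ fromℕ< x<n)                   ≡⟨ sym (Wf-fromℕ< x x<n) ⟩
    Wf x                                       ∎
    where open ≡-Reasoning

  agree⇒decomposition : ∀ as (v : Word n as) → Agree n (apply as) Wf → IsDecomposition w (letters as v)
  agree⇒decomposition as v ag i = toℕ-injective (begin
    toℕ (⟦ letters as v ⟧ i)                   ≡⟨ ⟦⟧-apply (letters as v) i ⟩
    apply (indices (letters as v)) (toℕ i)     ≡⟨ cong (λ us → apply us (toℕ i)) (indices-letters as v) ⟩
    apply as (toℕ i)                           ≡⟨ ag (toℕ i) (toℕ<n i) ⟩
    Wf (toℕ i)                                 ≡⟨ Wf-toℕ i ⟩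
    toℕ (w ⟨$⟩ʳ i)                             ∎)
    where open ≡-Reasoning

  reduced⇒rising : ∀ ws → IsReduced w ws → RisingFactor n Wf id (indices ws)
  -- (compare with the bubble-sort word, which has inversions n Wf letters)
  reduced⇒rising ws (dec , minimal) with vs , sorted@(v , _ , ag) ← sortWord n Wf Wf-inj Wf-bnd =
    shortest⇒rising n Wf (indices ws) (indices-word ws) (decomposition⇒agree ws dec) (begin
      length (indices ws)        ≡⟨ length-map (toℕ ∘ proj₁) ws ⟩
      length ws                  ≤⟨ minimal (letters vs v) (agree⇒decomposition vs v ag) ⟩
      length (letters vs v)      ≡⟨ length-letters vs v ⟩
      length vs                  ≡⟨ rising-length n Wf vs sorted ⟩
      inversions n Wf            ∎)
    where open ≤-Reasoning

  rising⇒reduced : ∀ as (fac : RisingFactor n Wf id as) → IsReduced w (letters as (proj₁ fac))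
  rising⇒reduced as fac@(v , _ , ag) = agree⇒decomposition as v ag , λ ws dec → begin
    length (letters as v)      ≡⟨ length-letters as v ⟩
    length as                  ≡⟨ rising-length n Wf as fac ⟩
    inversions n Wf            ≤⟨ word-length-≥ n Wf (indices ws) (indices-word ws) (decomposition⇒agree ws dec) ⟩
    length (indices ws)        ≡⟨ length-map (toℕ ∘ proj₁) ws ⟩
    length ws                  ∎
    where open ≤-Reasoning

  value : ∀ i → toℕ (w ⟨$⟩ʳ i) ≡ Wf (toℕ i)
  value i = sym (Wf-toℕ i)

  value-fromℕ< : ∀ {r} (h : r < n) → toℕ (w ⟨$⟩ʳ fromℕ< h) ≡ Wf r
  value-fromℕ< {r} h = sym (Wf-fromℕ< r h)

  value-< : ∀ i j → w ⟨$⟩ʳ i Fin.< w ⟨$⟩ʳ j → Wf (toℕ i) < Wf (toℕ j)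
  value-< i j = subst₂ _<_ (value i) (value j)

  position-< : ∀ {r s} (hr : r < n) (hs : s < n) → r < s → fromℕ< hr Fin.< fromℕ< hs
  position-< hr hs = subst₂ _<_ (sym (toℕ-fromℕ< hr)) (sym (toℕ-fromℕ< hs))

  fromℕ<-value-< : ∀ {r s} (hr : r < n) (hs : s < n) → Wf r < Wf s → w ⟨$⟩ʳ fromℕ< hr Fin.< w ⟨$⟩ʳ fromℕ< hs
  fromℕ<-value-< hr hs = subst₂ _<_ (sym (value-fromℕ< hr)) (sym (value-fromℕ< hs))

  -- A value or position x of the 0-based model sits at pos = x+1 in Defs.
  module _ (c : ℕ) where

    left-of-cut : ∀ {x y} → x ≡ y → y ≤ c → suc x ≤ suc c
    left-of-cut e y≤c = s≤s (subst (_≤ c) (sym e) y≤c)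

    right-of-cut : ∀ {x y} → x ≡ y → c < y → suc c < suc x
    right-of-cut e c<y = s≤s (subst (c <_) (sym e) c<y)

    straddle321⇒has321 : Straddle321 w (suc c) → Has321 n Wf c
    straddle321⇒has321 (i₁ , i₂ , i₃ , i₁<i₂ , i₂<i₃ , w₂<w₁ , w₃<w₂ , p₁ , p₃ , v₃ , v₁) =
      toℕ i₁ , toℕ i₂ , toℕ i₃ , toℕ<n i₃ , i₁<i₂ , i₂<i₃ , value-< i₂ i₁ w₂<w₁ , value-< i₃ i₂ w₃<w₂ ,
      ≤-pred p₁ , ≤-pred p₃ , subst (_≤ c) (value i₃) (≤-pred v₃) , subst (c <_) (value i₁) (≤-pred v₁)

    straddle3412⇒has3412 : Straddle3412 w (suc c) → Has3412 n Wf c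
    straddle3412⇒has3412
      (i₁ , i₂ , i₃ , i₄ , i₁<i₂ , i₂<i₃ , i₃<i₄ , w₃<w₄ , w₄<w₁ , w₁<w₂ , p₂ , p₃ , v₄ , v₁) =
      toℕ i₁ , toℕ i₂ , toℕ i₃ , toℕ i₄ , toℕ<n i₄ , i₁<i₂ , i₂<i₃ , i₃<i₄ ,
      value-< i₃ i₄ w₃<w₄ , value-< i₄ i₁ w₄<w₁ , value-< i₁ i₂ w₁<w₂ ,
      ≤-pred p₂ , ≤-pred p₃ , subst (_≤ c) (value i₄) (≤-pred v₄) , subst (c <_) (value i₁) (≤-pred v₁)

    has321⇒straddle321 : Has321 n Wf c → Straddle321 w (suc c)
    has321⇒straddle321 (r₁ , r₂ , r₃ , h₃ , r₁<r₂ , r₂<r₃ , W₂<W₁ , W₃<W₂ , r₁≤c , c<r₃ , W₃≤c , c<W₁) =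
      fromℕ< h₁ , fromℕ< h₂ , fromℕ< h₃ , position-< h₁ h₂ r₁<r₂ , position-< h₂ h₃ r₂<r₃ ,
      fromℕ<-value-< h₂ h₁ W₂<W₁ , fromℕ<-value-< h₃ h₂ W₃<W₂ ,
      left-of-cut (toℕ-fromℕ< h₁) r₁≤c , right-of-cut (toℕ-fromℕ< h₃) c<r₃ ,
      left-of-cut (value-fromℕ< h₃) W₃≤c , right-of-cut (value-fromℕ< h₁) c<W₁
      where
      h₂ = <-trans r₂<r₃ h₃
      h₁ = <-trans r₁<r₂ h₂

    has3412⇒straddle3412 : Has3412 n Wf c → Straddle3412 w (suc c)
    has3412⇒straddle3412
      (r₁ , r₂ , r₃ , r₄ , h₄ , r₁<r₂ , r₂<r₃ , r₃<r₄ , W₃<W₄ , W₄<W₁ , W₁<W₂ , r₂≤c , c<r₃ , W₄≤c , c<W₁) =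
      fromℕ< h₁ , fromℕ< h₂ , fromℕ< h₃ , fromℕ< h₄ ,
      position-< h₁ h₂ r₁<r₂ , position-< h₂ h₃ r₂<r₃ , position-< h₃ h₄ r₃<r₄ ,
      fromℕ<-value-< h₃ h₄ W₃<W₄ , fromℕ<-value-< h₄ h₁ W₄<W₁ , fromℕ<-value-< h₁ h₂ W₁<W₂ ,
      left-of-cut (toℕ-fromℕ< h₂) r₂≤c , right-of-cut (toℕ-fromℕ< h₃) c<r₃ ,
      left-of-cut (value-fromℕ< h₄) W₄≤c , right-of-cut (value-fromℕ< h₁) c<W₁
      where
      h₃ = <-trans r₃<r₄ h₄
      h₂ = <-trans r₂<r₃ h₃
      h₁ = <-trans r₁<r₂ h₂

    straddling⇒ : Straddle321 w (suc c) ⊎ Straddle3412 w (suc c) → Straddling n Wf c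
    straddling⇒ = Sum.map straddle321⇒has321 straddle3412⇒has3412

    straddling⇐ : Straddling n Wf c → Straddle321 w (suc c) ⊎ Straddle3412 w (suc c)
    straddling⇐ = Sum.map has321⇒straddle321 has3412⇒straddle3412

theorem3p3 : (n : ℕ) (w : Permutation′ n) (k : ℕ) → 1 ≤ k → k < n →
    (MaxkGreater w k 1 ⇔ (Straddle321 w k ⊎ Straddle3412 w k))
theorem3p3 n w (suc c) (s≤s z≤n) hc = mk⇔ to from
  where
  open Model w
  to : MaxkGreater w (suc c) 1 → Straddle321 w (suc c) ⊎ Straddle3412 w (suc c)
  to (ws , reduced , two) = straddling⇐ c (forward n c Wf (indices ws) hc Wf-inj Wf-bnd
    (reduced⇒rising ws reduced) (subst (2 ≤_) (occurrences-count c ws) two))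
  from : Straddle321 w (suc c) ⊎ Straddle3412 w (suc c) → MaxkGreater w (suc c) 1
  from patt with as , fac , two ← backward n c Wf (<-trans (n<1+n c) hc) Wf-inj Wf-bnd (straddling⇒ c patt) =
    letters as (proj₁ fac) , rising⇒reduced as fac , subst (2 ≤_) (sym (occurrences-letters c as (proj₁ fac))) two
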